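{- For a finite simple graph $G$, the following are equivalent: (1) $G$ is a line graph that contains no wheel and no diamond; (2) $G$ is the line graph of a triangle-free chordless graph; (3) $G$ contains no wheel, no diamond and no claw.
   Context: "Contains" means as an induced subgraph. A diamond is $K_4$ minus an edge. A claw is the graph with nodes $u,v_1,v_2,v_3$ and edges $uv_1,uv_2,uv_3$. A hole is a chordless cycle of length at least 4; a wheel is a hole $H$ together with a node $c\notin V(H)$ with at least three neighbors in $H$. A graph is chordless if every cycle of it is chordless. The line graph $L(R)$ of $R$ has the edges of $R$ as nodes, two adjacent when they share an end. -}

module Defs where

open import Data.Nat using (ℕ; zero; suc; _+_; _%_)
open import Data.Fin using (Fin; toℕ; zero; suc) renaming (_<_ to _<ᶠ_)
open import Data.Bool using (Bool; true; false)
open import Data.Product using (Σ; ∃; _×_; _,_; proj₁; proj₂)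
open import Data.Sum using (_⊎_)
open import Relation.Binary.PropositionalEquality using (_≡_; _≢_)
open import Relation.Nullary using (¬_)
open import Data.Empty using (⊥)
open import Function.Bundles using (_⇔_)
open import Function.Definitions using (Injective)

record Graph : Set where
  field
    n     : ℕ
    adj   : Fin n → Fin n → Bool
    sym   : ∀ u v → adj u v ≡ adj v u
    irrefl : ∀ v → adj v v ≡ false
open Graph public

Adj : (G : Graph) → Fin (n G) → Fin (n G) → Set
Adj G u v = adj G u v ≡ true

Contains : Graph → Graph → Set
Contains G H = Σ (Fin (n H) → Fin (n G)) λ f →
  Injective _≡_ _≡_ f × (∀ u v → adj G (f u) (f v) ≡ adj H u v)

-- Diamond: K4 minus the edge {0,1}.
diamondAdj : Fin 4 → Fin 4 → Bool
diamondAdj zero zero = false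
diamondAdj zero (suc zero) = false
diamondAdj (suc zero) zero = false
diamondAdj (suc zero) (suc zero) = false
diamondAdj (suc (suc zero)) (suc (suc zero)) = false
diamondAdj (suc (suc (suc zero))) (suc (suc (suc zero))) = false
diamondAdj _ _ = true

diamond : Graph
diamond = record { n = 4 ; adj = diamondAdj ; sym = s ; irrefl = i }
  where
  s : ∀ u v → diamondAdj u v ≡ diamondAdj v u
  s zero zero = _≡_.refl
  s zero (suc zero) = _≡_.refl
  s zero (suc (suc zero)) = _≡_.refl
  s zero (suc (suc (suc zero))) = _≡_.refl
  s (suc zero) zero = _≡_.refl
  s (suc zero) (suc zero) = _≡_.refl
  s (suc zero) (suc (suc zero)) = _≡_.refl
  s (suc zero) (suc (suc (suc zero))) = _≡_.refl
  s (suc (suc zero)) zero = _≡_.refl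
  s (suc (suc zero)) (suc zero) = _≡_.refl
  s (suc (suc zero)) (suc (suc zero)) = _≡_.refl
  s (suc (suc zero)) (suc (suc (suc zero))) = _≡_.refl
  s (suc (suc (suc zero))) zero = _≡_.refl
  s (suc (suc (suc zero))) (suc zero) = _≡_.refl
  s (suc (suc (suc zero))) (suc (suc zero)) = _≡_.refl
  s (suc (suc (suc zero))) (suc (suc (suc zero))) = _≡_.refl
  i : ∀ v → diamondAdj v v ≡ false
  i zero = _≡_.refl
  i (suc zero) = _≡_.refl
  i (suc (suc zero)) = _≡_.refl
  i (suc (suc (suc zero))) = _≡_.refl

clawAdj : Fin 4 → Fin 4 → Bool
clawAdj zero zero = false
clawAdj zero (suc _) = true
clawAdj (suc _) zero = true
clawAdj (suc _) (suc _) = false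

claw : Graph
claw = record { n = 4 ; adj = clawAdj ; sym = s ; irrefl = i }
  where
  s : ∀ u v → clawAdj u v ≡ clawAdj v u
  s zero zero = _≡_.refl
  s zero (suc _) = _≡_.refl
  s (suc _) zero = _≡_.refl
  s (suc _) (suc _) = _≡_.refl
  i : ∀ v → clawAdj v v ≡ false
  i zero = _≡_.refl
  i (suc _) = _≡_.refl

Consecutive : (k : ℕ) → Fin (suc k) → Fin (suc k) → Set
Consecutive k i j = toℕ j ≡ suc (toℕ i) % suc k ⊎ toℕ i ≡ suc (toℕ j) % suc k

IsHole : (G : Graph) (m : ℕ) → (Fin (4 + m) → Fin (n G)) → Set
IsHole G m h = Injective _≡_ _≡_ h ×
  (∀ i j → Adj G (h i) (h j) ⇔ Consecutive (3 + m) i j)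

ContainsWheel : Graph → Set
ContainsWheel G = Σ ℕ λ m → Σ (Fin (4 + m) → Fin (n G)) λ h → IsHole G m h ×
  Σ (Fin (n G)) λ c → (∀ i → h i ≢ c) ×
  Σ (Fin (4 + m)) λ i₁ → Σ (Fin (4 + m)) λ i₂ → Σ (Fin (4 + m)) λ i₃ →
    i₁ ≢ i₂ × i₁ ≢ i₃ × i₂ ≢ i₃ ×
    Adj G c (h i₁) × Adj G c (h i₂) × Adj G c (h i₃)

IsCycle : (R : Graph) (m : ℕ) → (Fin (3 + m) → Fin (n R)) → Set
IsCycle R m v = Injective _≡_ _≡_ v × (∀ i j → Consecutive (2 + m) i j → Adj R (v i) (v j))

Chordless : Graph → Set
Chordless R = ∀ m (v : Fin (3 + m) → Fin (n R)) → IsCycle R m v →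
  ∀ i j → Adj R (v i) (v j) → Consecutive (2 + m) i j

TriangleFree : Graph → Set
TriangleFree R = ∀ a b c → Adj R a b → Adj R b c → Adj R a c → ⊥

IsEdge : (R : Graph) → Fin (n R) × Fin (n R) → Set
IsEdge R (a , b) = a <ᶠ b × Adj R a b

ShareEnd : {k : ℕ} → Fin k × Fin k → Fin k × Fin k → Set
ShareEnd (a , b) (c , d) = a ≡ c ⊎ a ≡ d ⊎ b ≡ c ⊎ b ≡ d

IsLineGraphOf : Graph → Graph → Set
IsLineGraphOf G R = Σ (Fin (n G) → Fin (n R) × Fin (n R)) λ φ →
  (∀ x → IsEdge R (φ x)) ×
  Injective _≡_ _≡_ φ ×
  (∀ e → IsEdge R e → ∃ λ x → φ x ≡ e) ×
  (∀ x y → Adj G x y ⇔ (x ≢ y × ShareEnd (φ x) (φ y)))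

IsLineGraph : Graph → Set
IsLineGraph G = Σ Graph λ R → IsLineGraphOf G R

-- (2) ⇒ (3): a node of L(R) is an edge of R whose neighbours meet one of its two ends, so
-- L(R) has no claw; a diamond in L(R) forces a triangle in R; and a hole of L(R) consists of
-- the edges of a cycle C of R, so a wheel centre, an edge of R meeting three edges of C, has
-- both ends on C and is a chord.
-- (3) ⇒ (2): without claw and diamond the neighbourhood of every node splits into two cliques;
-- gluing the "ends" of adjacent nodes along them rebuilds a root R, which is triangle-free
-- since the two cliques at a node are separated, and a chord of a cycle of R would be the
-- centre of a wheel in G.
-- (1) ⇔ (2) follows because line graphs have no claw.

module Submission where

open import Data.Bool using (Bool; true; false; _∨_)
open import Data.Bool.Properties using () renaming (_≟_ to _≟ᵇ_)
open import Data.Empty using (⊥; ⊥-elim)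
open import Data.Fin using (Fin; zero; suc; toℕ; fromℕ; fromℕ<; inject₁; _↑ˡ_; _↑ʳ_; splitAt)
open import Data.Fin.Properties
  using (_≟_; suc-injective; toℕ-injective; toℕ-fromℕ<; toℕ-fromℕ; toℕ-inject₁; toℕ<n; toℕ≤pred[n]; any?; <-cmp; splitAt-↑ˡ; splitAt-↑ʳ)
  renaming (<-irrefl to <ᶠ-irrefl; <-trans to <ᶠ-trans)
open import Data.Maybe using (Maybe; just; nothing; fromMaybe; maybe′)
import Data.Maybe as Maybe
open import Data.Nat using (ℕ; zero; suc; _+_; _%_; _<_; s≤s; _<?_)
open import Data.Nat.DivMod using (m%n<n; m<n⇒m%n≡m; n%n≡0)
open import Data.Nat.Properties using (1+n≢n; m≢1+n+m; ≤-antisym; ≮⇒≥; <-irrefl) renaming (_≟_ to _≟ℕ_)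
open import Data.Product using (Σ; ∃; _×_; _,_; proj₁; proj₂; map₂)
open import Data.Sum using (_⊎_; inj₁; inj₂; [_,_]′; swap)
open import Function using (_∘_)
open import Function.Bundles using (_⇔_; mk⇔; Equivalence)
open import Function.Definitions using (Injective)
open import Relation.Binary.Definitions using (tri<; tri≈; tri>)
open import Relation.Binary.Structures using (IsDecEquivalence)
open import Relation.Binary.PropositionalEquality
open import Relation.Nullary using (¬_; Dec; yes; no; does)
open import Relation.Nullary.Decidable using (_×-dec_; _⊎-dec_; does-⇔; dec-true; dec-false)
open import Defs hiding (sym)

true≢false : true ≢ false
true≢false ()

does-true⇒ : ∀ {A : Set} (a? : Dec A) → does a? ≡ true → A
does-true⇒ (yes a) _ = a
does-true⇒ (no _) ()

-- Positions on a cycle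

next : ∀ {K} → Fin (suc K) → Fin (suc K)
next {K} i = fromℕ< (m%n<n (suc (toℕ i)) (suc K))

toℕ-next : ∀ {K} (i : Fin (suc K)) → toℕ (next i) ≡ suc (toℕ i) % suc K
toℕ-next {K} i = toℕ-fromℕ< (m%n<n (suc (toℕ i)) (suc K))

Consecutive⇒next : ∀ {K} {i j : Fin (suc K)} → Consecutive K i j → j ≡ next i ⊎ i ≡ next j
Consecutive⇒next {i = i} (inj₁ p) = inj₁ (toℕ-injective (trans p (sym (toℕ-next i))))
Consecutive⇒next {j = j} (inj₂ p) = inj₂ (toℕ-injective (trans p (sym (toℕ-next j))))

next⇒Consecutive : ∀ {K} {i j : Fin (suc K)} → j ≡ next i ⊎ i ≡ next j → Consecutive K i j
next⇒Consecutive {i = i} (inj₁ refl) = inj₁ (toℕ-next i)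
next⇒Consecutive {j = j} (inj₂ refl) = inj₂ (toℕ-next j)

Consecutive-next : ∀ {K} (i : Fin (suc K)) → Consecutive K i (next i)
Consecutive-next i = next⇒Consecutive (inj₁ refl)

Consecutive? : ∀ K (i j : Fin (suc K)) → Dec (Consecutive K i j)
Consecutive? K i j = (toℕ j ≟ℕ suc (toℕ i) % suc K) ⊎-dec (toℕ i ≟ℕ suc (toℕ j) % suc K)

distinct⇒Consecutive₃ : (i j : Fin 3) → i ≢ j → Consecutive 2 i j
distinct⇒Consecutive₃ zero             zero             i≢j = ⊥-elim (i≢j refl)
distinct⇒Consecutive₃ zero             (suc zero)       _   = inj₁ refl
distinct⇒Consecutive₃ zero             (suc (suc zero)) _   = inj₂ refl
distinct⇒Consecutive₃ (suc zero)       zero             _   = inj₂ refl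
distinct⇒Consecutive₃ (suc zero)       (suc zero)       i≢j = ⊥-elim (i≢j refl)
distinct⇒Consecutive₃ (suc zero)       (suc (suc zero)) _   = inj₁ refl
distinct⇒Consecutive₃ (suc (suc zero)) zero             _   = inj₁ refl
distinct⇒Consecutive₃ (suc (suc zero)) (suc zero)       _   = inj₂ refl
distinct⇒Consecutive₃ (suc (suc zero)) (suc (suc zero)) i≢j = ⊥-elim (i≢j refl)

data CyclicStep (K : ℕ) : ℕ → ℕ → Set where
  wrap : CyclicStep K K 0
  incr : ∀ {a} → a < K → CyclicStep K a (suc a)

cyclicStep : ∀ {K} (i : Fin (suc K)) → CyclicStep K (toℕ i) (toℕ (next i))
cyclicStep {K} i with toℕ i <? K
... | yes i<K = subst (CyclicStep K (toℕ i)) (sym (trans (toℕ-next i) (m<n⇒m%n≡m (s≤s i<K)))) (incr i<K)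
... | no i≮K = subst₂ (CyclicStep K) (sym i≡K) (sym next≡0) wrap
  where
  i≡K : toℕ i ≡ K
  i≡K = ≤-antisym (toℕ≤pred[n] i) (≮⇒≥ i≮K)
  next≡0 : toℕ (next i) ≡ 0
  next≡0 = begin
    toℕ (next i)         ≡⟨ toℕ-next i ⟩
    suc (toℕ i) % suc K  ≡⟨ cong (λ a → suc a % suc K) i≡K ⟩
    suc K % suc K        ≡⟨ n%n≡0 (suc K) ⟩
    0                    ∎
    where open ≡-Reasoning

cyclicStep-injective : ∀ {K a b c} → CyclicStep K a c → CyclicStep K b c → a ≡ b
cyclicStep-injective wrap     wrap     = refl
cyclicStep-injective (incr _) (incr _) = refl

next-injective : ∀ {K} → Injective _≡_ _≡_ (next {K})
next-injective {x = i} {j} e =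
  toℕ-injective (cyclicStep-injective (cyclicStep i) (subst (CyclicStep _ (toℕ j)) (cong toℕ (sym e)) (cyclicStep j)))

-- Returning to the start needs a wrap, hence at least K + 1 steps.
next≢id : ∀ {K} (i : Fin (2 + K)) → next i ≢ i
next≢id i e = one-step (cyclicStep i) (cong toℕ e)
  where
  one-step : ∀ {K a b} → CyclicStep (suc K) a b → b ≢ a
  one-step wrap     ()
  one-step (incr _) e = 1+n≢n e

next²≢id : ∀ {K} (i : Fin (3 + K)) → next (next i) ≢ i
next²≢id i e = two-steps (cyclicStep i) (cyclicStep (next i)) (cong toℕ e)
  where
  two-steps : ∀ {K a b c} → CyclicStep (2 + K) a b → CyclicStep (2 + K) b c → c ≢ a
  two-steps wrap     (incr _) ()
  two-steps (incr _) wrap     ()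
  two-steps (incr _) (incr _) e = m≢1+n+m _ {1} (sym e)

next³≢id : ∀ {K} (i : Fin (4 + K)) → next (next (next i)) ≢ i
next³≢id i e = three-steps (cyclicStep i) (cyclicStep (next i)) (cyclicStep (next (next i))) (cong toℕ e)
  where
  three-steps : ∀ {K a b c d} → CyclicStep (3 + K) a b → CyclicStep (3 + K) b c → CyclicStep (3 + K) c d → d ≢ a
  three-steps wrap     (incr _) (incr _) ()
  three-steps (incr _) wrap     (incr _) ()
  three-steps (incr _) (incr _) wrap     ()
  three-steps (incr _) (incr _) (incr _) e = m≢1+n+m _ {2} (sym e)

prev : ∀ {K} → Fin (suc K) → Fin (suc K)
prev {K}     zero    = fromℕ K
prev {suc K} (suc j) = inject₁ j

next-prev : ∀ {K} (i : Fin (suc K)) → next (prev i) ≡ i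
next-prev {K} zero = toℕ-injective (wraps (toℕ-fromℕ K) (cyclicStep (fromℕ K)))
  where
  wraps : ∀ {a b} → a ≡ K → CyclicStep K a b → b ≡ 0
  wraps _    wrap       = refl
  wraps a≡K (incr a<K) = ⊥-elim (<-irrefl a≡K a<K)
next-prev {suc K} (suc j) = toℕ-injective (increments (toℕ-inject₁ j) (cyclicStep (inject₁ j)))
  where
  increments : ∀ {a b} → a ≡ toℕ j → CyclicStep (suc K) a b → b ≡ suc (toℕ j)
  increments a≡j wrap     = ⊥-elim (<-irrefl (sym a≡j) (toℕ<n j))
  increments a≡j (incr _) = cong suc a≡j

prev≢id : ∀ {K} (i : Fin (2 + K)) → prev i ≢ i
prev≢id i e = next≢id i (trans (cong next (sym e)) (next-prev i))

first : ∀ {k} {P : Fin k → Set} → (∀ x → Dec (P x)) → Maybe (Fin k)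
first {zero}  P? = nothing
first {suc k} P? with P? zero
... | yes _ = just zero
... | no _  = Maybe.map suc (first (P? ∘ suc))

first-sound : ∀ {k} {P : Fin k → Set} (P? : ∀ x → Dec (P x)) {x} → first P? ≡ just x → P x
first-sound {suc k} P? e with P? zero
first-sound {suc k} P? refl | yes p0 = p0
... | no _ with first (P? ∘ suc) in eq
first-sound {suc k} P? refl | no _ | just y = first-sound (P? ∘ suc) eq

first-complete : ∀ {k} {P : Fin k → Set} (P? : ∀ x → Dec (P x)) {x} → P x → ∃ λ y → first P? ≡ just y
first-complete {suc k} P? px with P? zero
... | yes _ = zero , refl
first-complete {suc k} P? {zero}  px | no ¬p0 = ⊥-elim (¬p0 px)
first-complete {suc k} P? {suc x} px | no _ with first-complete (P? ∘ suc) px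
... | y , eq = suc y , cong (Maybe.map suc) eq

first-cong : ∀ {k} {P Q : Fin k → Set} (P? : ∀ x → Dec (P x)) (Q? : ∀ x → Dec (Q x)) →
  (∀ x → P x ⇔ Q x) → first P? ≡ first Q?
first-cong {zero}  P? Q? P⇔Q = refl
first-cong {suc k} P? Q? P⇔Q with P? zero | Q? zero
... | yes _  | yes _  = refl
... | yes p0 | no ¬q0 = ⊥-elim (¬q0 (Equivalence.to (P⇔Q zero) p0))
... | no ¬p0 | yes q0 = ⊥-elim (¬p0 (Equivalence.from (P⇔Q zero) q0))
... | no _   | no _   = cong (Maybe.map suc) (first-cong (P? ∘ suc) (Q? ∘ suc) (P⇔Q ∘ suc))

-- canon a is the least index of an element equivalent to a; it stands in for the quotient map.
module Canonical {k : ℕ} {A : Set} {_≈_ : A → A → Set} (isDecEquivalence : IsDecEquivalence _≈_)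
  (decode : Fin k → A) (encode : A → Fin k) (decode-encode : ∀ a → decode (encode a) ≡ a) where

  private
    module ≈ = IsDecEquivalence isDecEquivalence

  represents? : (a : A) (x : Fin k) → Dec (decode x ≈ a)
  represents? a x = decode x ≈.≟ a

  opaque
    canon : A → Fin k
    canon a = fromMaybe (encode a) (first (represents? a))

    first-represents : ∀ a → ∃ λ x → first (represents? a) ≡ just x
    first-represents a = first-complete (represents? a) (subst (_≈ a) (sym (decode-encode a)) ≈.refl)

    canon-just : ∀ {a x} → first (represents? a) ≡ just x → canon a ≡ x
    canon-just eq rewrite eq = refl

    canon-represents : ∀ a → decode (canon a) ≈ a
    canon-represents a with first-represents a
    ... | x , eq = subst (λ y → decode y ≈ a) (sym (canon-just eq)) (first-sound (represents? a) eq)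

    canon-cong : ∀ {a b} → a ≈ b → canon a ≡ canon b
    canon-cong {a} {b} a≈b with first-represents a
    ... | x , eq = trans (canon-just eq) (sym (canon-just (trans (sym same-search) eq)))
      where
      same-search : first (represents? a) ≡ first (represents? b)
      same-search = first-cong (represents? a) (represents? b)
        (λ y → mk⇔ (λ y≈a → ≈.trans y≈a a≈b) (λ y≈b → ≈.trans y≈b (≈.sym a≈b)))

  canon-injective : ∀ {a b} → canon a ≡ canon b → a ≈ b
  canon-injective {a} {b} eq =
    ≈.trans (≈.sym (canon-represents a)) (subst (λ y → decode y ≈ b) (sym eq) (canon-represents b))

-- Edges as pairs of ends

_∈ₑ_ : ∀ {k} → Fin k → Fin k × Fin k → Set
z ∈ₑ (a , b) = a ≡ z ⊎ b ≡ z

_∈ₑ?_ : ∀ {k} (z : Fin k) (e : Fin k × Fin k) → Dec (z ∈ₑ e)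
z ∈ₑ? (a , b) = (a ≟ z) ⊎-dec (b ≟ z)

ShareEnd⇒common-end : ∀ {k} (p q : Fin k × Fin k) → ShareEnd p q → ∃ λ z → z ∈ₑ p × z ∈ₑ q
ShareEnd⇒common-end (a , b) (c , d) (inj₁ a≡c)               = a , inj₁ refl , inj₁ (sym a≡c)
ShareEnd⇒common-end (a , b) (c , d) (inj₂ (inj₁ a≡d))        = a , inj₁ refl , inj₂ (sym a≡d)
ShareEnd⇒common-end (a , b) (c , d) (inj₂ (inj₂ (inj₁ b≡c))) = b , inj₂ refl , inj₁ (sym b≡c)
ShareEnd⇒common-end (a , b) (c , d) (inj₂ (inj₂ (inj₂ b≡d))) = b , inj₂ refl , inj₂ (sym b≡d)

common-end⇒ShareEnd : ∀ {k} (p q : Fin k × Fin k) {z} → z ∈ₑ p → z ∈ₑ q → ShareEnd p q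
common-end⇒ShareEnd (a , b) (c , d) (inj₁ refl) (inj₁ refl) = inj₁ refl
common-end⇒ShareEnd (a , b) (c , d) (inj₁ refl) (inj₂ refl) = inj₂ (inj₁ refl)
common-end⇒ShareEnd (a , b) (c , d) (inj₂ refl) (inj₁ refl) = inj₂ (inj₂ (inj₁ refl))
common-end⇒ShareEnd (a , b) (c , d) (inj₂ refl) (inj₂ refl) = inj₂ (inj₂ (inj₂ refl))

∈ₑ-two-ends : ∀ {k} (e : Fin k × Fin k) {x y z} → x ∈ₑ e → y ∈ₑ e → x ≢ y → z ∈ₑ e → z ≡ x ⊎ z ≡ y
∈ₑ-two-ends (a , b) (inj₁ refl) (inj₁ refl) x≢y _           = ⊥-elim (x≢y refl)
∈ₑ-two-ends (a , b) (inj₁ refl) (inj₂ refl) _   (inj₁ refl) = inj₁ refl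
∈ₑ-two-ends (a , b) (inj₁ refl) (inj₂ refl) _   (inj₂ refl) = inj₂ refl
∈ₑ-two-ends (a , b) (inj₂ refl) (inj₁ refl) _   (inj₁ refl) = inj₂ refl
∈ₑ-two-ends (a , b) (inj₂ refl) (inj₁ refl) _   (inj₂ refl) = inj₁ refl
∈ₑ-two-ends (a , b) (inj₂ refl) (inj₂ refl) x≢y _           = ⊥-elim (x≢y refl)

∉-two-ends : ∀ {k} (e : Fin k × Fin k) {x y z} → x ∈ₑ e → y ∈ₑ e → x ≢ y → z ≢ x → z ≢ y → ¬ z ∈ₑ e
∉-two-ends e x∈ y∈ x≢y z≢x z≢y z∈ = [ z≢x , z≢y ]′ (∈ₑ-two-ends e x∈ y∈ x≢y z∈)

pigeonhole-pair : ∀ {A : Set} {x y z r s : A} → x ≢ y → x ≢ z → y ≢ z →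
  x ≡ r ⊎ x ≡ s → y ≡ r ⊎ y ≡ s → z ≡ r ⊎ z ≡ s → ⊥
pigeonhole-pair x≢y _   _   (inj₁ refl) (inj₁ refl) _           = x≢y refl
pigeonhole-pair x≢y _   _   (inj₂ refl) (inj₂ refl) _           = x≢y refl
pigeonhole-pair _   x≢z _   (inj₁ refl) (inj₂ refl) (inj₁ refl) = x≢z refl
pigeonhole-pair _   _   y≢z (inj₁ refl) (inj₂ refl) (inj₂ refl) = y≢z refl
pigeonhole-pair _   _   y≢z (inj₂ refl) (inj₁ refl) (inj₁ refl) = y≢z refl
pigeonhole-pair _   x≢z _   (inj₂ refl) (inj₁ refl) (inj₂ refl) = x≢z refl

sortPair : ∀ {k} → Fin k → Fin k → Fin k × Fin k
sortPair a b with <-cmp a b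
... | tri< _ _ _ = a , b
... | tri≈ _ _ _ = a , b
... | tri> _ _ _ = b , a

∈ₑ-sortPair⁻ : ∀ {k} (a b : Fin k) {z} → z ∈ₑ sortPair a b → z ∈ₑ (a , b)
∈ₑ-sortPair⁻ a b z∈ with <-cmp a b
... | tri< _ _ _ = z∈
... | tri≈ _ _ _ = z∈
... | tri> _ _ _ = swap z∈

∈ₑ-sortPair⁺ : ∀ {k} (a b : Fin k) {z} → z ∈ₑ (a , b) → z ∈ₑ sortPair a b
∈ₑ-sortPair⁺ a b z∈ with <-cmp a b
... | tri< _ _ _ = z∈
... | tri≈ _ _ _ = z∈
... | tri> _ _ _ = swap z∈

quad : ∀ {A : Set} → A → A → A → A → Fin 4 → A
quad a b c d zero                   = a
quad a b c d (suc zero)             = b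
quad a b c d (suc (suc zero))       = c
quad a b c d (suc (suc (suc zero))) = d

quad-injective : ∀ {A : Set} {a b c d : A} → a ≢ b → a ≢ c → a ≢ d → b ≢ c → b ≢ d → c ≢ d →
  Injective _≡_ _≡_ (quad a b c d)
quad-injective a≢b a≢c a≢d b≢c b≢d c≢d = injective
  where
  injective : Injective _≡_ _≡_ (quad _ _ _ _)
  injective {zero}                   {zero}                   _ = refl
  injective {zero}                   {suc zero}               e = ⊥-elim (a≢b e)
  injective {zero}                   {suc (suc zero)}         e = ⊥-elim (a≢c e)
  injective {zero}                   {suc (suc (suc zero))}   e = ⊥-elim (a≢d e)
  injective {suc zero}               {zero}                   e = ⊥-elim (a≢b (sym e))
  injective {suc zero}               {suc zero}               _ = refl
  injective {suc zero}               {suc (suc zero)}         e = ⊥-elim (b≢c e)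
  injective {suc zero}               {suc (suc (suc zero))}   e = ⊥-elim (b≢d e)
  injective {suc (suc zero)}         {zero}                   e = ⊥-elim (a≢c (sym e))
  injective {suc (suc zero)}         {suc zero}               e = ⊥-elim (b≢c (sym e))
  injective {suc (suc zero)}         {suc (suc zero)}         _ = refl
  injective {suc (suc zero)}         {suc (suc (suc zero))}   e = ⊥-elim (c≢d e)
  injective {suc (suc (suc zero))}   {zero}                   e = ⊥-elim (a≢d (sym e))
  injective {suc (suc (suc zero))}   {suc zero}               e = ⊥-elim (b≢d (sym e))
  injective {suc (suc (suc zero))}   {suc (suc zero)}         e = ⊥-elim (c≢d (sym e))
  injective {suc (suc (suc zero))}   {suc (suc (suc zero))}   _ = refl

module _ (G : Graph) where

  Adj⇒¬false : ∀ {x y} → Adj G x y → adj G x y ≢ false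
  Adj⇒¬false xy xy-false = true≢false (trans (sym xy) xy-false)

  adj-irrefl : ∀ x → ¬ Adj G x x
  adj-irrefl x xx = Adj⇒¬false xx (irrefl G x)

  adj-sym : ∀ {x y} → Adj G x y → Adj G y x
  adj-sym {x} {y} xy = trans (Graph.sym G y x) xy

  adj⇒≢ : ∀ {x y} → Adj G x y → x ≢ y
  adj⇒≢ {x} xy refl = adj-irrefl x xy

  sortPair-IsEdge : ∀ {a b} → a ≢ b → Adj G a b → IsEdge G (sortPair a b)
  sortPair-IsEdge {a} {b} a≢b ab with <-cmp a b
  ... | tri< a<b _ _ = a<b , ab
  ... | tri≈ _ a≡b _ = ⊥-elim (a≢b a≡b)
  ... | tri> _ _ b<a = b<a , adj-sym ab

  IsEdge⇒adj : ∀ {e x y} → IsEdge G e → x ∈ₑ e → y ∈ₑ e → x ≢ y → Adj G x y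
  IsEdge⇒adj (_ , ab) (inj₁ refl) (inj₁ refl) x≢y = ⊥-elim (x≢y refl)
  IsEdge⇒adj (_ , ab) (inj₁ refl) (inj₂ refl) _   = ab
  IsEdge⇒adj (_ , ab) (inj₂ refl) (inj₁ refl) _   = adj-sym ab
  IsEdge⇒adj (_ , ab) (inj₂ refl) (inj₂ refl) x≢y = ⊥-elim (x≢y refl)

  IsEdge-ext : ∀ {e e'} → IsEdge G e → IsEdge G e' → (∀ z → z ∈ₑ e → z ∈ₑ e') → e ≡ e'
  IsEdge-ext {a , b} {c , d} (a<b , _) (c<d , _) e⊆e' with e⊆e' a (inj₁ refl) | e⊆e' b (inj₂ refl)
  ... | inj₁ refl | inj₁ refl = ⊥-elim (<ᶠ-irrefl refl a<b)
  ... | inj₁ refl | inj₂ refl = refl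
  ... | inj₂ refl | inj₁ refl = ⊥-elim (<ᶠ-irrefl refl (<ᶠ-trans a<b c<d))
  ... | inj₂ refl | inj₂ refl = ⊥-elim (<ᶠ-irrefl refl a<b)

  claw-at : ∀ {v a b c} → Adj G v a → Adj G v b → Adj G v c → a ≢ b → a ≢ c → b ≢ c →
    adj G a b ≡ false → adj G a c ≡ false → adj G b c ≡ false → Contains G claw
  claw-at {v} {a} {b} {c} va vb vc a≢b a≢c b≢c ab ac bc =
    quad v a b c , quad-injective (adj⇒≢ va) (adj⇒≢ vb) (adj⇒≢ vc) a≢b a≢c b≢c , induced
    where
    induced : ∀ u w → adj G (quad v a b c u) (quad v a b c w) ≡ clawAdj u w
    induced zero                   zero                   = irrefl G v
    induced zero                   (suc zero)             = va
    induced zero                   (suc (suc zero))       = vb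
    induced zero                   (suc (suc (suc zero))) = vc
    induced (suc zero)             zero                   = adj-sym va
    induced (suc (suc zero))       zero                   = adj-sym vb
    induced (suc (suc (suc zero))) zero                   = adj-sym vc
    induced (suc zero)             (suc zero)             = irrefl G a
    induced (suc zero)             (suc (suc zero))       = ab
    induced (suc zero)             (suc (suc (suc zero))) = ac
    induced (suc (suc zero))       (suc zero)             = trans (Graph.sym G b a) ab
    induced (suc (suc zero))       (suc (suc zero))       = irrefl G b
    induced (suc (suc zero))       (suc (suc (suc zero))) = bc
    induced (suc (suc (suc zero))) (suc zero)             = trans (Graph.sym G c a) ac
    induced (suc (suc (suc zero))) (suc (suc zero))       = trans (Graph.sym G c b) bc
    induced (suc (suc (suc zero))) (suc (suc (suc zero))) = irrefl G c

  diamond-at : ∀ {a b c d} → adj G a b ≡ false → Adj G a c → Adj G a d → Adj G b c → Adj G b d →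
    Adj G c d → a ≢ b → Contains G diamond
  diamond-at {a} {b} {c} {d} ab ac ad bc bd cd a≢b =
    quad a b c d , quad-injective a≢b (adj⇒≢ ac) (adj⇒≢ ad) (adj⇒≢ bc) (adj⇒≢ bd) (adj⇒≢ cd) , induced
    where
    induced : ∀ u w → adj G (quad a b c d u) (quad a b c d w) ≡ diamondAdj u w
    induced zero                   zero                   = irrefl G a
    induced zero                   (suc zero)             = ab
    induced zero                   (suc (suc zero))       = ac
    induced zero                   (suc (suc (suc zero))) = ad
    induced (suc zero)             zero                   = trans (Graph.sym G b a) ab
    induced (suc zero)             (suc zero)             = irrefl G b
    induced (suc zero)             (suc (suc zero))       = bc
    induced (suc zero)             (suc (suc (suc zero))) = bd
    induced (suc (suc zero))       zero                   = adj-sym ac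
    induced (suc (suc zero))       (suc zero)             = adj-sym bc
    induced (suc (suc zero))       (suc (suc zero))       = irrefl G c
    induced (suc (suc zero))       (suc (suc (suc zero))) = cd
    induced (suc (suc (suc zero))) zero                   = adj-sym ad
    induced (suc (suc (suc zero))) (suc zero)             = adj-sym bd
    induced (suc (suc (suc zero))) (suc (suc zero))       = adj-sym cd
    induced (suc (suc (suc zero))) (suc (suc (suc zero))) = irrefl G d

module LineGraph (G R : Graph) (lg : IsLineGraphOf G R) where

  φ : Fin (n G) → Fin (n R) × Fin (n R)
  φ = proj₁ lg

  φ-edge : ∀ x → IsEdge R (φ x)
  φ-edge = proj₁ (proj₂ lg)

  φ-injective : Injective _≡_ _≡_ φ
  φ-injective = proj₁ (proj₂ (proj₂ lg))

  φ-surjective : ∀ e → IsEdge R e → ∃ λ x → φ x ≡ e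
  φ-surjective = proj₁ (proj₂ (proj₂ (proj₂ lg)))

  adj⇔ : ∀ x y → Adj G x y ⇔ (x ≢ y × ShareEnd (φ x) (φ y))
  adj⇔ = proj₂ (proj₂ (proj₂ (proj₂ lg)))

  adj⇒common-end : ∀ {x y} → Adj G x y → ∃ λ z → z ∈ₑ φ x × z ∈ₑ φ y
  adj⇒common-end {x} {y} xy = ShareEnd⇒common-end (φ x) (φ y) (proj₂ (Equivalence.to (adj⇔ x y) xy))

  common-end⇒adj : ∀ {x y z} → x ≢ y → z ∈ₑ φ x → z ∈ₑ φ y → Adj G x y
  common-end⇒adj {x} {y} x≢y zx zy = Equivalence.from (adj⇔ x y) (x≢y , common-end⇒ShareEnd (φ x) (φ y) zx zy)

  adj⇒meets-end : ∀ {c l} → Adj G c l → proj₁ (φ c) ∈ₑ φ l ⊎ proj₂ (φ c) ∈ₑ φ l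
  adj⇒meets-end cl with adj⇒common-end cl
  ... | _ , inj₁ refl , z∈l = inj₁ z∈l
  ... | _ , inj₂ refl , z∈l = inj₂ z∈l

  edge⇒node : ∀ {a b} → Adj R a b → ∃ λ x → a ∈ₑ φ x × b ∈ₑ φ x
  edge⇒node {a} {b} ab with φ-surjective (sortPair a b) (sortPair-IsEdge R (adj⇒≢ R ab) ab)
  ... | x , φx≡ab = x , subst (a ∈ₑ_) (sym φx≡ab) (∈ₑ-sortPair⁺ a b (inj₁ refl))
                      , subst (b ∈ₑ_) (sym φx≡ab) (∈ₑ-sortPair⁺ a b (inj₂ refl))

  claw-free : ¬ Contains G claw
  claw-free (f , f-injective , f-adj) = two-leaves-meet (meets l₁) (meets l₂) (meets l₃)
    where
    l₁ l₂ l₃ : Fin 3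
    l₁ = zero
    l₂ = suc zero
    l₃ = suc (suc zero)
    Meets : Fin 3 → Set
    Meets l = proj₁ (φ (f zero)) ∈ₑ φ (f (suc l)) ⊎ proj₂ (φ (f zero)) ∈ₑ φ (f (suc l))
    meets : ∀ l → Meets l
    meets l = adj⇒meets-end (f-adj zero (suc l))
    leaves-disjoint : ∀ p q {z} → p ≢ q → z ∈ₑ φ (f (suc p)) → z ∈ₑ φ (f (suc q)) → ⊥
    leaves-disjoint p q p≢q zp zq =
      Adj⇒¬false G (common-end⇒adj (λ eq → p≢q (suc-injective (f-injective eq))) zp zq) (f-adj (suc p) (suc q))
    two-leaves-meet : Meets l₁ → Meets l₂ → Meets l₃ → ⊥
    two-leaves-meet (inj₁ a₁) (inj₁ a₂) _         = leaves-disjoint l₁ l₂ (λ ()) a₁ a₂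
    two-leaves-meet (inj₂ b₁) (inj₂ b₂) _         = leaves-disjoint l₁ l₂ (λ ()) b₁ b₂
    two-leaves-meet (inj₁ a₁) (inj₂ _)  (inj₁ a₃) = leaves-disjoint l₁ l₃ (λ ()) a₁ a₃
    two-leaves-meet (inj₁ _)  (inj₂ b₂) (inj₂ b₃) = leaves-disjoint l₂ l₃ (λ ()) b₂ b₃
    two-leaves-meet (inj₂ _)  (inj₁ a₂) (inj₁ a₃) = leaves-disjoint l₂ l₃ (λ ()) a₂ a₃
    two-leaves-meet (inj₂ b₁) (inj₁ _)  (inj₂ b₃) = leaves-disjoint l₁ l₃ (λ ()) b₁ b₃

  -- Otherwise the edges of x, u and y would form a triangle in R.
  common-neighbour-has-end : TriangleFree R → ∀ {u x y e} → x ≢ y → e ∈ₑ φ x → e ∈ₑ φ y →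
    Adj G u x → Adj G u y → e ∈ₑ φ u
  common-neighbour-has-end tf {u} {x} {y} {e} x≢y ex ey ux uy with e ∈ₑ? φ u
  ... | yes eu = eu
  ... | no e∉u with adj⇒common-end ux | adj⇒common-end uy
  ...   | a , au , ax | b , bu , by =
    ⊥-elim (tf e a b (IsEdge⇒adj R (φ-edge x) ex ax e≢a) (IsEdge⇒adj R (φ-edge u) au bu a≢b) (IsEdge⇒adj R (φ-edge y) ey by e≢b))
    where
    e≢a : e ≢ a
    e≢a refl = e∉u au
    e≢b : e ≢ b
    e≢b refl = e∉u bu
    a≢b : a ≢ b
    a≢b refl = x≢y (φ-injective (IsEdge-ext R (φ-edge x) (φ-edge y) φx⊆φy))
      where
      φx⊆φy : ∀ z → z ∈ₑ φ x → z ∈ₑ φ y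
      φx⊆φy z zx = [ (λ { refl → ey }) , (λ { refl → by }) ]′ (∈ₑ-two-ends (φ x) ex ax e≢a zx)

  diamond-free : TriangleFree R → ¬ Contains G diamond
  diamond-free tf (f , f-injective , f-adj) with adj⇒common-end (f-adj (suc (suc zero)) (suc (suc (suc zero))))
  ... | e , ec , ed = Adj⇒¬false G (common-end⇒adj a≢b (has-e zero refl refl) (has-e (suc zero) refl refl)) (f-adj zero (suc zero))
    where
    a≢b : f zero ≢ f (suc zero)
    a≢b eq with f-injective eq
    ... | ()
    c≢d : f (suc (suc zero)) ≢ f (suc (suc (suc zero)))
    c≢d eq with f-injective eq
    ... | ()
    has-e : ∀ t → adj diamond t (suc (suc zero)) ≡ true → adj diamond t (suc (suc (suc zero))) ≡ true → e ∈ₑ φ (f t)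
    has-e t tc td = common-neighbour-has-end tf c≢d ec ed (trans (f-adj t _) tc) (trans (f-adj t _) td)

  module HoleJunctions {m} {h : Fin (4 + m) → Fin (n G)} (hole : IsHole G m h) where

    h-injective : Injective _≡_ _≡_ h
    h-injective = proj₁ hole

    adj⇒Consecutive : ∀ {r s} → Adj G (h r) (h s) → Consecutive (3 + m) r s
    adj⇒Consecutive {r} {s} = Equivalence.to (proj₂ hole r s)

    adj-next : ∀ p → Adj G (h p) (h (next p))
    adj-next p = Equivalence.from (proj₂ hole p (next p)) (Consecutive-next p)

    junction : Fin (4 + m) → Fin (n R)
    junction p = proj₁ (adj⇒common-end (adj-next p))

    junction-∈-here : ∀ p → junction p ∈ₑ φ (h p)
    junction-∈-here p = proj₁ (proj₂ (adj⇒common-end (adj-next p)))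

    junction-∈-next : ∀ p → junction p ∈ₑ φ (h (next p))
    junction-∈-next p = proj₂ (proj₂ (adj⇒common-end (adj-next p)))

    junction-∈-prev : ∀ r → junction (prev r) ∈ₑ φ (h r)
    junction-∈-prev r = subst (λ t → junction (prev r) ∈ₑ φ (h t)) (next-prev r) (junction-∈-next (prev r))

    common-end⇒near : ∀ {r s z} → z ∈ₑ φ (h r) → z ∈ₑ φ (h s) → r ≡ s ⊎ s ≡ next r ⊎ r ≡ next s
    common-end⇒near {r} {s} zr zs with r ≟ s
    ... | yes r≡s = inj₁ r≡s
    ... | no r≢s = inj₂ (Consecutive⇒next (adj⇒Consecutive (common-end⇒adj (r≢s ∘ h-injective) zr zs)))

    ¬common-end-two-apart : ∀ {p z} → z ∈ₑ φ (h p) → z ∈ₑ φ (h (next (next p))) → ⊥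
    ¬common-end-two-apart {p} zp zp² with common-end⇒near zp zp²
    ... | inj₁ p≡p²        = next²≢id p (sym p≡p²)
    ... | inj₂ (inj₁ p²≡p¹) = next≢id p (next-injective p²≡p¹)
    ... | inj₂ (inj₂ p≡p³) = next³≢id p (sym p≡p³)

    junction-injective : Injective _≡_ _≡_ junction
    junction-injective {p} {q} eq with p ≟ q
    ... | yes p≡q = p≡q
    ... | no p≢q with common-end⇒near (junction-∈-here p) (subst (_∈ₑ φ (h q)) (sym eq) (junction-∈-here q))
    ...   | inj₁ p≡q = ⊥-elim (p≢q p≡q)
    ...   | inj₂ (inj₁ refl) = ⊥-elim (¬common-end-two-apart (junction-∈-here p) (subst (_∈ₑ _) (sym eq) (junction-∈-next (next p))))
    ...   | inj₂ (inj₂ refl) = ⊥-elim (¬common-end-two-apart (junction-∈-here q) (subst (_∈ₑ _) eq (junction-∈-next (next q))))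

    ∈⇒junction : ∀ {r z} → z ∈ₑ φ (h r) → z ≡ junction r ⊎ z ≡ junction (prev r)
    ∈⇒junction {r} z∈ = ∈ₑ-two-ends (φ (h r)) (junction-∈-here r) (junction-∈-prev r)
      (λ eq → prev≢id r (sym (junction-injective eq))) z∈

    end-is-junction : ∀ {r z} → z ∈ₑ φ (h r) → ∃ λ p → junction p ≡ z
    end-is-junction {r} z∈ = [ (λ eq → r , sym eq) , (λ eq → prev r , sym eq) ]′ (∈⇒junction z∈)

    junction-∈⇒ : ∀ {q r} → junction q ∈ₑ φ (h r) → r ≡ q ⊎ r ≡ next q
    junction-∈⇒ {q} {r} j∈ with ∈⇒junction j∈
    ... | inj₁ eq = inj₁ (sym (junction-injective eq))
    ... | inj₂ eq = inj₂ (trans (sym (next-prev r)) (cong next (sym (junction-injective eq))))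

    junction-cycle : IsCycle R (suc m) junction
    junction-cycle = junction-injective , consecutive-adj
      where
      adj-next-junction : ∀ p → Adj R (junction p) (junction (next p))
      adj-next-junction p = IsEdge⇒adj R (φ-edge (h (next p))) (junction-∈-next p) (junction-∈-here (next p))
        (λ eq → next≢id p (sym (junction-injective eq)))
      consecutive-adj : ∀ i j → Consecutive (3 + m) i j → Adj R (junction i) (junction j)
      consecutive-adj i j c with Consecutive⇒next c
      ... | inj₁ refl = adj-next-junction i
      ... | inj₂ refl = adj-sym R (adj-next-junction j)

  -- A wheel centre c meets the hole through its two ends A and B.  Three neighbours cannot
  -- all contain the same end, since a junction lies on two hole nodes only; and if A and B
  -- both lie on the hole, the edge AB of R is a chord unless c is itself a hole node.
  wheel-free : Chordless R → ¬ ContainsWheel G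
  wheel-free ch (m , h , hole , c , c∉h , i₁ , i₂ , i₃ , i₁≢i₂ , i₁≢i₃ , i₂≢i₃ , ci₁ , ci₂ , ci₃) =
    three-neighbours (adj⇒meets-end ci₁) (adj⇒meets-end ci₂) (adj⇒meets-end ci₃)
    where
    open HoleJunctions hole
    A B : Fin (n R)
    A = proj₁ (φ c)
    B = proj₂ (φ c)
    Meets : Fin (4 + m) → Set
    Meets i = A ∈ₑ φ (h i) ⊎ B ∈ₑ φ (h i)
    one-end-thrice : ∀ {Z} → Z ∈ₑ φ (h i₁) → Z ∈ₑ φ (h i₂) → Z ∈ₑ φ (h i₃) → ⊥
    one-end-thrice z₁ z₂ z₃ with end-is-junction z₁
    ... | r , refl = pigeonhole-pair i₁≢i₂ i₁≢i₃ i₂≢i₃ (junction-∈⇒ z₁) (junction-∈⇒ z₂) (junction-∈⇒ z₃)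
    spans : ∀ p → A ∈ₑ φ (h (next p)) → B ∈ₑ φ (h (next p)) → ⊥
    spans p A∈ B∈ = c∉h (next p) (sym (φ-injective (IsEdge-ext R (φ-edge c) (φ-edge (h (next p))) φc⊆)))
      where
      φc⊆ : ∀ z → z ∈ₑ φ c → z ∈ₑ φ (h (next p))
      φc⊆ _ (inj₁ refl) = A∈
      φc⊆ _ (inj₂ refl) = B∈
    both-ends : ∀ {r s} → A ∈ₑ φ (h r) → B ∈ₑ φ (h s) → ⊥
    both-ends A∈ B∈ with end-is-junction A∈ | end-is-junction B∈
    ... | p , jp≡A | q , jq≡B
      with Consecutive⇒next (ch (suc m) junction junction-cycle p q (subst₂ (Adj R) (sym jp≡A) (sym jq≡B) (proj₂ (φ-edge c))))
    ... | inj₁ refl = spans p (subst (_∈ₑ _) jp≡A (junction-∈-next p)) (subst (_∈ₑ _) jq≡B (junction-∈-here (next p)))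
    ... | inj₂ refl = spans q (subst (_∈ₑ _) jp≡A (junction-∈-here (next q))) (subst (_∈ₑ _) jq≡B (junction-∈-next q))
    three-neighbours : Meets i₁ → Meets i₂ → Meets i₃ → ⊥
    three-neighbours (inj₁ a₁) (inj₁ a₂) (inj₁ a₃) = one-end-thrice a₁ a₂ a₃
    three-neighbours (inj₂ b₁) (inj₂ b₂) (inj₂ b₃) = one-end-thrice b₁ b₂ b₃
    three-neighbours (inj₁ a₁) (inj₂ b₂) _         = both-ends a₁ b₂
    three-neighbours (inj₂ b₁) (inj₁ a₂) _         = both-ends a₂ b₁
    three-neighbours (inj₁ a₁) (inj₁ _)  (inj₂ b₃) = both-ends a₁ b₃
    three-neighbours (inj₂ b₁) (inj₂ _)  (inj₁ a₃) = both-ends a₃ b₁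

  module CycleEdges {m} {v : Fin (4 + m) → Fin (n R)} (cycle : IsCycle R (suc m) v) where

    v-injective : Injective _≡_ _≡_ v
    v-injective = proj₁ cycle

    v≢v-next : ∀ p → v p ≢ v (next p)
    v≢v-next p eq = next≢id p (sym (v-injective eq))

    edge-at : Fin (4 + m) → Fin (n G)
    edge-at p = proj₁ (edge⇒node (proj₂ cycle p (next p) (Consecutive-next p)))

    here-∈ : ∀ p → v p ∈ₑ φ (edge-at p)
    here-∈ p = proj₁ (proj₂ (edge⇒node (proj₂ cycle p (next p) (Consecutive-next p))))

    next-∈ : ∀ p → v (next p) ∈ₑ φ (edge-at p)
    next-∈ p = proj₂ (proj₂ (edge⇒node (proj₂ cycle p (next p) (Consecutive-next p))))

    ∈-edge-at : ∀ {p z} → z ∈ₑ φ (edge-at p) → z ≡ v p ⊎ z ≡ v (next p)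
    ∈-edge-at {p} = ∈ₑ-two-ends (φ (edge-at p)) (here-∈ p) (next-∈ p) (v≢v-next p)

    edge-at-injective : Injective _≡_ _≡_ edge-at
    edge-at-injective {p} {q} eq with ∈-edge-at (subst (λ x → v p ∈ₑ φ x) eq (here-∈ p))
    ... | inj₁ vp≡vq = v-injective vp≡vq
    ... | inj₂ vp≡vq¹ with v-injective vp≡vq¹ | ∈-edge-at (subst (λ x → v (next p) ∈ₑ φ x) eq (next-∈ p))
    ...   | refl | inj₁ vp¹≡vq = ⊥-elim (next²≢id q (v-injective vp¹≡vq))
    ...   | refl | inj₂ vp¹≡vq¹ = next-injective (v-injective vp¹≡vq¹)

    common-end⇒Consecutive : ∀ {p q z} → edge-at p ≢ edge-at q → z ∈ₑ φ (edge-at p) → z ∈ₑ φ (edge-at q) →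
      Consecutive (3 + m) p q
    common-end⇒Consecutive {p} {q} p≢q zp zq with ∈-edge-at zp | ∈-edge-at zq
    ... | inj₁ refl | inj₁ vp≡vq  = ⊥-elim (p≢q (cong edge-at (v-injective vp≡vq)))
    ... | inj₁ refl | inj₂ vp≡vq¹ = next⇒Consecutive (inj₂ (v-injective vp≡vq¹))
    ... | inj₂ refl | inj₁ vp¹≡vq = next⇒Consecutive (inj₁ (sym (v-injective vp¹≡vq)))
    ... | inj₂ refl | inj₂ vp¹≡vq¹ = ⊥-elim (p≢q (cong edge-at (next-injective (v-injective vp¹≡vq¹))))

    edges-hole : IsHole G m edge-at
    edges-hole = edge-at-injective , λ p q → mk⇔ (adj⇒Consecutive p q) (Consecutive⇒adj p q)
      where
      adj⇒Consecutive : ∀ p q → Adj G (edge-at p) (edge-at q) → Consecutive (3 + m) p q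
      adj⇒Consecutive p q pq with adj⇒common-end pq
      ... | z , zp , zq = common-end⇒Consecutive (adj⇒≢ G pq) zp zq
      Consecutive⇒adj : ∀ p q → Consecutive (3 + m) p q → Adj G (edge-at p) (edge-at q)
      Consecutive⇒adj p q c with Consecutive⇒next c
      ... | inj₁ refl = common-end⇒adj (λ eq → next≢id p (sym (edge-at-injective eq))) (next-∈ p) (here-∈ (next p))
      ... | inj₂ refl = common-end⇒adj (λ eq → next≢id q (edge-at-injective eq)) (here-∈ (next q)) (next-∈ q)

    -- The chord's node meets the hole edges at i, at prev i and at j.
    chord⇒wheel : ∀ {i j} → Adj R (v i) (v j) → ¬ Consecutive (3 + m) i j → ContainsWheel G
    chord⇒wheel {i} {j} vij ¬ij with edge⇒node vij
    ... | c , vi∈c , vj∈c =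
      m , edge-at , edges-hole , c , c∉hole , i , j , prev i , i≢j , i≢prev-i , j≢prev-i ,
      common-end⇒adj (λ eq → c∉hole i (sym eq)) vi∈c (here-∈ i) ,
      common-end⇒adj (λ eq → c∉hole j (sym eq)) vj∈c (here-∈ j) ,
      common-end⇒adj (λ eq → c∉hole (prev i) (sym eq)) vi∈c (subst (λ t → v t ∈ₑ φ (edge-at (prev i))) (next-prev i) (next-∈ (prev i)))
      where
      i≢j : i ≢ j
      i≢j eq = adj⇒≢ R vij (cong v eq)
      i≢prev-i : i ≢ prev i
      i≢prev-i eq = prev≢id i (sym eq)
      j≢prev-i : j ≢ prev i
      j≢prev-i eq = ¬ij (next⇒Consecutive (inj₂ (trans (sym (next-prev i)) (cong next (sym eq)))))
      c∉hole : ∀ p → edge-at p ≢ c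
      c∉hole p refl with ∈-edge-at vi∈c | ∈-edge-at vj∈c
      ... | inj₁ vi≡vp | inj₁ vj≡vp = i≢j (v-injective (trans vi≡vp (sym vj≡vp)))
      ... | inj₁ vi≡vp | inj₂ vj≡vp¹ = ¬ij (next⇒Consecutive (inj₁ (trans (v-injective vj≡vp¹) (cong next (sym (v-injective vi≡vp))))))
      ... | inj₂ vi≡vp¹ | inj₁ vj≡vp = ¬ij (next⇒Consecutive (inj₂ (trans (v-injective vi≡vp¹) (cong next (sym (v-injective vj≡vp))))))
      ... | inj₂ vi≡vp¹ | inj₂ vj≡vp¹ = i≢j (v-injective (trans vi≡vp¹ (sym vj≡vp¹)))

  wheel-free⇒chordless : ¬ ContainsWheel G → Chordless R
  wheel-free⇒chordless _ zero v _ i j vij = distinct⇒Consecutive₃ i j (λ eq → adj⇒≢ R vij (cong v eq))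
  wheel-free⇒chordless ¬wheel (suc m) v cycle i j vij with Consecutive? (3 + m) i j
  ... | yes ij = ij
  ... | no ¬ij = ⊥-elim (¬wheel (CycleEdges.chord⇒wheel cycle vij ¬ij))

-- Without claw and diamond the neighbours of v fall into two cliques; `side v u` records which
-- one contains u, namely whether u is, or is adjacent to, a fixed reference neighbour of v.
-- The root has one vertex per class of ends: (v , s) is the end of v on side s, and the ends
-- through which two adjacent nodes meet are identified. The node v is the edge between its ends.
module RootGraph (G : Graph) (¬claw : ¬ Contains G claw) (¬diamond : ¬ Contains G diamond) where

  V : Set
  V = Fin (n G)

  onSideOf : V → V → Bool
  onSideOf m u = does (u ≟ m) ∨ adj G u m

  adj⇒same-sideOf : ∀ {v m u w} → Adj G v m → Adj G v u → Adj G v w → u ≢ w → Adj G u w →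
    onSideOf m u ≡ onSideOf m w
  adj⇒same-sideOf {v} {m} {u} {w} vm vu vw u≢w uw with u ≟ m | w ≟ m
  ... | yes refl | yes refl = ⊥-elim (u≢w refl)
  ... | yes refl | no _ = sym (adj-sym G uw)
  ... | no _ | yes refl = uw
  ... | no u≢m | no w≢m with adj G u m in um | adj G w m in wm
  ...   | true  | true  = refl
  ...   | false | false = refl
  ...   | true  | false = ⊥-elim (¬diamond (diamond-at G wm (adj-sym G vw) (adj-sym G uw) (adj-sym G vm) (adj-sym G um) vu w≢m))
  ...   | false | true  = ⊥-elim (¬diamond (diamond-at G um (adj-sym G vu) uw (adj-sym G vm) (adj-sym G wm) vw u≢m))

  same-sideOf⇒adj : ∀ {v m u w} → Adj G v m → Adj G v u → Adj G v w → u ≢ w →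
    onSideOf m u ≡ onSideOf m w → Adj G u w
  same-sideOf⇒adj {v} {m} {u} {w} vm vu vw u≢w same with u ≟ m | w ≟ m
  ... | yes refl | yes refl = ⊥-elim (u≢w refl)
  ... | yes refl | no _ = adj-sym G (sym same)
  ... | no _ | yes refl = same
  ... | no u≢m | no w≢m with adj G u w in uw
  ...   | true = refl
  ...   | false with adj G u m in um | adj G w m in wm
  ...     | true  | true  = ⊥-elim (¬diamond (diamond-at G uw (adj-sym G vu) um (adj-sym G vw) wm vm u≢w))
  ...     | false | false = ⊥-elim (¬claw (claw-at G vm vu vw (u≢m ∘ sym) (w≢m ∘ sym) u≢w
                                               (trans (Graph.sym G m u) um) (trans (Graph.sym G m w) wm) uw))
  ...     | true  | false = ⊥-elim (true≢false same)
  ...     | false | true  = ⊥-elim (true≢false (sym same))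

  reference : V → Maybe V
  reference v = first (λ m → adj G v m ≟ᵇ true)

  side : V → V → Bool
  side v u = maybe′ (λ m → onSideOf m u) false (reference v)

  adj⇒same-side : ∀ {v u w} → Adj G v u → Adj G v w → u ≢ w → Adj G u w → side v u ≡ side v w
  adj⇒same-side {v} vu vw u≢w uw with first-complete (λ m → adj G v m ≟ᵇ true) vu
  ... | m , eq rewrite eq = adj⇒same-sideOf (first-sound (λ m → adj G v m ≟ᵇ true) eq) vu vw u≢w uw

  same-side⇒adj : ∀ {v u w} → Adj G v u → Adj G v w → u ≢ w → side v u ≡ side v w → Adj G u w
  same-side⇒adj {v} vu vw u≢w same with first-complete (λ m → adj G v m ≟ᵇ true) vu
  ... | m , eq rewrite eq = same-sideOf⇒adj (first-sound (λ m → adj G v m ≟ᵇ true) eq) vu vw u≢w same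

  End : Set
  End = V × Bool

  _≈ᵉ_ : End → End → Set
  (v , s) ≈ᵉ (w , t) = (v ≡ w × s ≡ t) ⊎ (Adj G v w × side v w ≡ s × side w v ≡ t)

  _≈ᵉ?_ : ∀ e e' → Dec (e ≈ᵉ e')
  (v , s) ≈ᵉ? (w , t) = ((v ≟ w) ×-dec (s ≟ᵇ t)) ⊎-dec ((adj G v w ≟ᵇ true) ×-dec ((side v w ≟ᵇ s) ×-dec (side w v ≟ᵇ t)))

  ≈ᵉ-refl : ∀ {e} → e ≈ᵉ e
  ≈ᵉ-refl = inj₁ (refl , refl)

  ≈ᵉ-sym : ∀ {e e'} → e ≈ᵉ e' → e' ≈ᵉ e
  ≈ᵉ-sym (inj₁ (refl , refl)) = inj₁ (refl , refl)
  ≈ᵉ-sym (inj₂ (vw , s , t)) = inj₂ (adj-sym G vw , t , s)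

  ≈ᵉ-trans : ∀ {e e' e''} → e ≈ᵉ e' → e' ≈ᵉ e'' → e ≈ᵉ e''
  ≈ᵉ-trans (inj₁ (refl , refl)) q = q
  ≈ᵉ-trans (inj₂ p) (inj₁ (refl , refl)) = inj₂ p
  ≈ᵉ-trans {v , s} {w , t} {x , r} (inj₂ (vw , side-vw , side-wv)) (inj₂ (wx , side-wx , side-xw)) with v ≟ x
  ... | yes refl = inj₁ (refl , trans (sym side-vw) side-xw)
  ... | no v≢x = inj₂ (vx , trans (sym (adj⇒same-side vw vx (adj⇒≢ G wx) wx)) side-vw
                         , trans (sym (adj⇒same-side (adj-sym G wx) (adj-sym G vx) (adj⇒≢ G vw ∘ sym) (adj-sym G vw))) side-xw)
    where
    vx : Adj G v x
    vx = same-side⇒adj (adj-sym G vw) wx v≢x (trans side-wv (sym side-wx))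

  ≈ᵉ-isDecEquivalence : IsDecEquivalence _≈ᵉ_
  ≈ᵉ-isDecEquivalence = record
    { isEquivalence = record { refl = ≈ᵉ-refl ; sym = ≈ᵉ-sym ; trans = ≈ᵉ-trans }
    ; _≟_ = _≈ᵉ?_
    }

  N : ℕ
  N = n G + n G

  encode : End → Fin N
  encode (v , false) = v ↑ˡ n G
  encode (v , true)  = n G ↑ʳ v

  decode : Fin N → End
  decode x = [ (_, false) , (_, true) ]′ (splitAt (n G) x)

  decode-encode : ∀ e → decode (encode e) ≡ e
  decode-encode (v , false) rewrite splitAt-↑ˡ (n G) v (n G) = refl
  decode-encode (v , true)  rewrite splitAt-↑ʳ (n G) (n G) v = refl

  open Canonical ≈ᵉ-isDecEquivalence decode encode decode-encode

  end : V → Bool → Fin N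
  end v s = canon (v , s)

  end-injective : ∀ {v s t} → end v s ≡ end v t → s ≡ t
  end-injective {v} eq with canon-injective eq
  ... | inj₁ (_ , s≡t) = s≡t
  ... | inj₂ (vv , _) = ⊥-elim (adj-irrefl G v vv)

  end-false≢end-true : ∀ v → end v false ≢ end v true
  end-false≢end-true v eq with end-injective eq
  ... | ()

  Joins : Fin N → Fin N → V → Set
  Joins a b v = (a ≡ end v false × b ≡ end v true) ⊎ (a ≡ end v true × b ≡ end v false)

  joins? : ∀ a b v → Dec (Joins a b v)
  joins? a b v = ((a ≟ end v false) ×-dec (b ≟ end v true)) ⊎-dec ((a ≟ end v true) ×-dec (b ≟ end v false))

  Joins-sym : ∀ {a b v} → Joins a b v → Joins b a v
  Joins-sym (inj₁ (a≡ , b≡)) = inj₂ (b≡ , a≡)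
  Joins-sym (inj₂ (a≡ , b≡)) = inj₁ (b≡ , a≡)

  root-adj : Fin N → Fin N → Bool
  root-adj a b = does (any? (joins? a b))

  root : Graph
  root = record
    { n = N
    ; adj = root-adj
    ; sym = λ a b → does-⇔ (mk⇔ (map₂ Joins-sym) (map₂ Joins-sym)) (any? (joins? a b)) (any? (joins? b a))
    ; irrefl = λ a → dec-false (any? (joins? a a)) λ
        { (v , inj₁ (a≡ , a≡')) → end-false≢end-true v (trans (sym a≡) a≡')
        ; (v , inj₂ (a≡ , a≡')) → end-false≢end-true v (trans (sym a≡') a≡) }
    }

  φ : V → Fin N × Fin N
  φ v = sortPair (end v false) (end v true)

  φ-edge : ∀ v → IsEdge root (φ v)
  φ-edge v = sortPair-IsEdge root (end-false≢end-true v) (dec-true (any? (joins? _ _)) (v , inj₁ (refl , refl)))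

  end-∈φ : ∀ v s → end v s ∈ₑ φ v
  end-∈φ v false = ∈ₑ-sortPair⁺ (end v false) (end v true) (inj₁ refl)
  end-∈φ v true  = ∈ₑ-sortPair⁺ (end v false) (end v true) (inj₂ refl)

  ∈φ⇒end : ∀ {v z} → z ∈ₑ φ v → ∃ λ s → end v s ≡ z
  ∈φ⇒end {v} z∈ = [ (λ eq → false , eq) , (λ eq → true , eq) ]′ (∈ₑ-sortPair⁻ (end v false) (end v true) z∈)

  common-end⇒adj×side : ∀ {x y z} → x ≢ y → z ∈ₑ φ x → z ∈ₑ φ y →
    Adj G x y × ∃ λ s → end x s ≡ z × side x y ≡ s
  common-end⇒adj×side {x} {y} x≢y zx zy with ∈φ⇒end zx | ∈φ⇒end zy
  ... | s , xs≡z | t , yt≡z with canon-injective (trans xs≡z (sym yt≡z))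
  ...   | inj₁ (x≡y , _) = ⊥-elim (x≢y x≡y)
  ...   | inj₂ (xy , side≡s , _) = xy , s , xs≡z , side≡s

  φ-injective : Injective _≡_ _≡_ φ
  φ-injective {x} {y} φx≡φy with x ≟ y
  ... | yes x≡y = x≡y
  ... | no x≢y = ⊥-elim (true≢false (trans (sym (side≡ true)) (side≡ false)))
    where
    side≡ : ∀ s → side x y ≡ s
    side≡ s with common-end⇒adj×side x≢y (end-∈φ x s) (subst (end x s ∈ₑ_) φx≡φy (end-∈φ x s))
    ... | _ , t , xt≡xs , side≡t = trans side≡t (end-injective xt≡xs)

  joins⇒ends-∈ : ∀ {a b v} → Joins a b v → ∀ s → end v s ∈ₑ (a , b)
  joins⇒ends-∈ (inj₁ (refl , refl)) false = inj₁ refl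
  joins⇒ends-∈ (inj₁ (refl , refl)) true  = inj₂ refl
  joins⇒ends-∈ (inj₂ (refl , refl)) false = inj₂ refl
  joins⇒ends-∈ (inj₂ (refl , refl)) true  = inj₁ refl

  φ-surjective : ∀ e → IsEdge root e → ∃ λ v → φ v ≡ e
  φ-surjective (a , b) (a<b , ab) with does-true⇒ (any? (joins? a b)) ab
  ... | v , joins = v , IsEdge-ext root (φ-edge v) (a<b , ab) φv⊆
    where
    φv⊆ : ∀ z → z ∈ₑ φ v → z ∈ₑ (a , b)
    φv⊆ z z∈ with ∈φ⇒end z∈
    ... | s , refl = joins⇒ends-∈ joins s

  adj⇒ShareEnd : ∀ {x y} → Adj G x y → ShareEnd (φ x) (φ y)
  adj⇒ShareEnd {x} {y} xy = common-end⇒ShareEnd (φ x) (φ y) (end-∈φ x (side x y))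
    (subst (_∈ₑ φ y) (canon-cong (inj₂ (adj-sym G xy , refl , refl))) (end-∈φ y (side y x)))

  root-line-graph : IsLineGraphOf G root
  root-line-graph = φ , φ-edge , φ-injective , φ-surjective , λ x y → mk⇔
    (λ xy → adj⇒≢ G xy , adj⇒ShareEnd xy)
    (λ { (x≢y , share) → let (z , zx , zy) = ShareEnd⇒common-end (φ x) (φ y) share in proj₁ (common-end⇒adj×side x≢y zx zy) })

  open LineGraph G root root-line-graph using (edge⇒node)

  -- The three edges of a triangle abc come from pairwise adjacent nodes x, y, z; y and z lie
  -- on the same side of x, so x meets them through the same end, forcing a = b.
  root-triangle-free : TriangleFree root
  root-triangle-free a b c ab bc ac with edge⇒node ab | edge⇒node bc | edge⇒node ac
  ... | x , a∈x , b∈x | y , b∈y , c∈y | z , a∈z , c∈z = adj⇒≢ root ab a≡b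
    where
    x≢y : x ≢ y
    x≢y refl = ∉-two-ends (φ x) a∈x b∈x (adj⇒≢ root ab) (adj⇒≢ root ac ∘ sym) (adj⇒≢ root bc ∘ sym) c∈y
    x≢z : x ≢ z
    x≢z refl = ∉-two-ends (φ x) a∈x b∈x (adj⇒≢ root ab) (adj⇒≢ root ac ∘ sym) (adj⇒≢ root bc ∘ sym) c∈z
    y≢z : y ≢ z
    y≢z refl = ∉-two-ends (φ y) b∈y c∈y (adj⇒≢ root bc) (adj⇒≢ root ab) (adj⇒≢ root ac) a∈z
    y-side : Adj G x y × ∃ λ s → end x s ≡ b × side x y ≡ s
    y-side = common-end⇒adj×side x≢y b∈x b∈y
    z-side : Adj G x z × ∃ λ s → end x s ≡ a × side x z ≡ s
    z-side = common-end⇒adj×side x≢z a∈x a∈z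
    same-side : side x y ≡ side x z
    same-side = adj⇒same-side (proj₁ y-side) (proj₁ z-side) y≢z (proj₁ (common-end⇒adj×side y≢z c∈y c∈z))
    a≡b : a ≡ b
    a≡b with y-side | z-side
    ... | _ , sb , xsb≡b , side-y | _ , sa , xsa≡a , side-z = begin
      a          ≡⟨ sym xsa≡a ⟩
      end x sa   ≡⟨ cong (end x) (trans (sym side-z) (trans (sym same-side) side-y)) ⟩
      end x sb   ≡⟨ xsb≡b ⟩
      b          ∎
      where open ≡-Reasoning

wheel-diamond-claw-free⇒root : ∀ G → ¬ ContainsWheel G → ¬ Contains G diamond → ¬ Contains G claw →
  Σ Graph λ R → TriangleFree R × Chordless R × IsLineGraphOf G R
wheel-diamond-claw-free⇒root G ¬wheel ¬diamond ¬claw =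
  root , root-triangle-free , LineGraph.wheel-free⇒chordless G root root-line-graph ¬wheel , root-line-graph
  where open RootGraph G ¬claw ¬diamond

lemma2p4 : (G : Graph) →
    ((IsLineGraph G × ¬ ContainsWheel G × ¬ Contains G diamond)
      ⇔ (Σ Graph λ R → TriangleFree R × Chordless R × IsLineGraphOf G R))
    × ((Σ Graph λ R → TriangleFree R × Chordless R × IsLineGraphOf G R)
      ⇔ (¬ ContainsWheel G × ¬ Contains G diamond × ¬ Contains G claw))
lemma2p4 G =
  mk⇔ (λ { ((R , lg) , ¬wheel , ¬diamond) → wheel-diamond-claw-free⇒root G ¬wheel ¬diamond (LineGraph.claw-free G R lg) })
      (λ { (R , tf , ch , lg) → (R , lg) , LineGraph.wheel-free G R lg ch , LineGraph.diamond-free G R lg tf }) ,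
  mk⇔ (λ { (R , tf , ch , lg) → LineGraph.wheel-free G R lg ch , LineGraph.diamond-free G R lg tf , LineGraph.claw-free G R lg })
      (λ { (¬wheel , ¬diamond , ¬claw) → wheel-diamond-claw-free⇒root G ¬wheel ¬diamond ¬claw })
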